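{- For every $n\ge1$, the number of ascent sequences of length $n$ avoiding the pattern $012$ is $2^{n-1}$, and for every $k\ge0$ the number of such sequences with exactly $k$ ascents is $\binom{n}{2k}$.
   Context: An ascent sequence is a finite sequence $x_1x_2\ldots x_n$ of nonnegative integers with $x_1=0$ and $x_i\le \operatorname{asc}(x_1\ldots x_{i-1})+1$ for all $1<i\le n$, where $\operatorname{asc}(y_1\ldots y_k)$, the number of ascents, is the number of indices $j$ with $y_j<y_{j+1}$. A pattern is a finite word over the nonnegative integers (repetitions allowed). An occurrence of a pattern $p=p_1\ldots p_k$ in a sequence $x_1\ldots x_n$ is a subsequence $x_{i_1}\ldots x_{i_k}$ with $i_1<\cdots<i_k$ such that for all $a,b$: $x_{i_a}<x_{i_b}$ iff $p_a<p_b$, and $x_{i_a}=x_{i_b}$ iff $p_a=p_b$. A sequence avoids $p$ if it has no occurrence of $p$. Thus avoiding $012$ means having no subsequence $x_{i_1}<x_{i_2}<x_{i_3}$ with $i_1<i_2<i_3$. -}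

module Defs where

open import Data.Nat using (ℕ; zero; suc; _+_; _<_; _≤_; _<?_; _^_; _∸_)
open import Data.List using (List; []; _∷_; length; take; lookup)
open import Data.List.Membership.Propositional using (_∈_)
open import Data.List.Relation.Unary.Unique.Propositional using (Unique)
open import Data.Fin using (Fin; toℕ; zero; suc) renaming (_<_ to _<ᶠ_)
open import Data.Product using (_×_; ∃-syntax; Σ-syntax)
open import Relation.Nullary using (¬_; yes; no)
open import Relation.Binary.PropositionalEquality using (_≡_)
open import Function.Bundles using (_⇔_)

ascFrom : ℕ → List ℕ → ℕ
ascFrom y [] = 0
ascFrom y (z ∷ ys) with y <? z
... | yes _ = suc (ascFrom z ys)
... | no _  = ascFrom z ys

asc : List ℕ → ℕ
asc [] = 0
asc (y ∷ ys) = ascFrom y ys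

-- A sequence x₁ … xₙ is represented as a list; the entry at 0-based
-- position i is x_{i+1}, and  take i x  is the prefix x₁ … x_i.
-- Ascent sequence: x₁ = 0 and x_i ≤ asc(x₁ … x_{i-1}) + 1 for 1 < i ≤ n,
-- i.e. for every 0-based position i ≥ 1:  lookup x i ≤ asc (take i x) + 1.
IsAscentSeq : List ℕ → Set
IsAscentSeq x =
  (∀ (i : Fin (length x)) → toℕ i ≡ 0 → lookup x i ≡ 0) ×
  (∀ (i : Fin (length x)) → 1 ≤ toℕ i → lookup x i ≤ asc (take (toℕ i) x) + 1)

Contains012 : List ℕ → Set
Contains012 x = ∃[ i ] ∃[ j ] ∃[ k ]
  (i <ᶠ j × j <ᶠ k × lookup x i < lookup x j × lookup x j < lookup x k)

Avoids012 : List ℕ → Set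
Avoids012 x = ¬ Contains012 x

HasCount : {A : Set} → (A → Set) → ℕ → Set
HasCount {A} P m = Σ[ l ∈ List A ] (Unique l × (∀ a → (a ∈ l ⇔ P a)) × length l ≡ m)

Av012 : ℕ → List ℕ → Set
Av012 n x = length x ≡ n × IsAscentSeq x × Avoids012 x

module Submission where

-- In a 012-avoiding ascent sequence every entry is
--   at most 1: if an earlier entry equals 1, the leading 0, that 1 and a
--   larger entry would form 012; otherwise (by strong induction on the
--   position) the prefix consists of zeros, has no ascent, and the
--   ascent-sequence bound caps the entry at 1.  Conversely every word
--   0 w with w a binary word is a 012-avoiding ascent sequence.  So the
--   sequences of length m+1 are exactly  0 ∷ w  with w binary of length m.
--
-- With a few general counting principles for 'HasCount'
--   (equivalent predicates, disjoint unions, prefixing a fixed letter) we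
--   count binary words of length n by splitting on the first letter:
--   there are 2^n of them, and those with k ascents after a preceding
--   letter b ∈ {0,1} number C(n+1, 2k+b), by Pascal's rule.

open import Defs
open import Data.Nat using (ℕ; _≤_; _^_; _∸_; _*_)
open import Data.Nat.Combinatorics using (_C_)
open import Data.Product using (_×_)
open import Relation.Binary.PropositionalEquality using (_≡_)

open import Level using (0ℓ)
open import Data.Nat using (zero; suc; _+_; _<_; z≤n; s≤s; _<?_; _≟_; _≤?_)
open import Data.Nat.Properties using (+-comm; +-identityʳ; *-suc; ≤-trans; m≤n+m; ≰⇒>; suc-injective)
open import Data.Nat.Combinatorics using (k>n⇒nCk≡0; nCk+nC[k+1]≡[n+1]C[k+1])
open import Data.List using (List; []; _∷_; length; take; lookup; map; _++_)
open import Data.List.Properties using (length-++; length-map; ∷-injectiveˡ; ∷-injectiveʳ)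
open import Data.List.Relation.Unary.All as All using (All; []; _∷_)
open import Data.List.Relation.Unary.Any using (here; index)
open import Data.List.Relation.Unary.Any.Properties using (lookup-index)
open import Data.List.Membership.Propositional using (_∈_)
open import Data.List.Membership.Propositional.Properties using (∈-map⁺; ∈-map⁻; ∈-++⁺ˡ; ∈-++⁺ʳ; ∈-++⁻; ∈-lookup)
import Data.List.Relation.Unary.Unique.Propositional.Properties as Unique
import Data.List.Relation.Unary.AllPairs as AllPairs
open import Data.Fin using (Fin; toℕ) renaming (zero to fzero; suc to fsuc; _<_ to _<ᶠ_)
open import Data.Fin.Properties using (any?)
open import Data.Fin.Induction using (<-wellFounded)
open import Induction.WellFounded as WellFounded using ()
open import Data.Product using (∃; _,_; proj₁; proj₂)
open import Data.Empty using (⊥-elim)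
import Data.Sum as Sum
open Sum using (_⊎_; inj₁; inj₂)
open import Relation.Nullary using (¬_; yes; no)
open import Relation.Nullary.Decidable using (_×-dec_)
open import Relation.Binary.PropositionalEquality using (refl; sym; trans; cong; cong₂; subst; module ≡-Reasoning)
open import Function.Bundles using (_⇔_; mk⇔; Equivalence)
open import Function.Construct.Composition using (_⇔-∘_)
open import Function.Construct.Symmetry using (⇔-sym)

open Equivalence using (to; from)

_◂_ : {A : Set} → A → (List A → Set) → List A → Set
(c ◂ P) v = ∃ λ w → v ≡ c ∷ w × P w

module _ {A : Set} where

  count-via : {P Q : A → Set} {m : ℕ} →
              (∀ a → P a ⇔ Q a) → HasCount Q m → HasCount P m
  count-via P⇔Q (l , unique , member , len) =
    l , unique , (λ a → ⇔-sym (P⇔Q a) ⇔-∘ member a) , len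

  count-none : {P : A → Set} → (∀ a → ¬ P a) → HasCount P 0
  count-none none = [] , AllPairs.[] , (λ a → mk⇔ (λ ()) (λ Pa → ⊥-elim (none a Pa))) , refl

  count-single : (a : A) → HasCount (_≡ a) 1
  count-single a = a ∷ [] , [] AllPairs.∷ AllPairs.[] , (λ b → mk⇔ unhere (λ { refl → here refl })) , refl
    where
    unhere : ∀ {b} → b ∈ a ∷ [] → b ≡ a
    unhere (here b≡a) = b≡a

  count-⊎ : {P Q : A → Set} {m n : ℕ} → (∀ a → P a → ¬ Q a) →
            HasCount P m → HasCount Q n → HasCount (λ a → P a ⊎ Q a) (m + n)
  count-⊎ {P} {Q} disjoint (l , unique-l , member-l , len-l) (r , unique-r , member-r , len-r) =
    l ++ r , Unique.++⁺ unique-l unique-r apart , (λ a → mk⇔ (split a) (join a)) ,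
    trans (length-++ l) (cong₂ _+_ len-l len-r)
    where
    apart : ∀ {a} → ¬ (a ∈ l × a ∈ r)
    apart {a} (a∈l , a∈r) = disjoint a (to (member-l a) a∈l) (to (member-r a) a∈r)
    split : ∀ a → a ∈ l ++ r → P a ⊎ Q a
    split a a∈ = Sum.map (to (member-l a)) (to (member-r a)) (∈-++⁻ l a∈)
    join : ∀ a → P a ⊎ Q a → a ∈ l ++ r
    join a (inj₁ Pa) = ∈-++⁺ˡ (from (member-l a) Pa)
    join a (inj₂ Qa) = ∈-++⁺ʳ l (from (member-r a) Qa)

  count-◂ : {P : List A → Set} {m : ℕ} (c : A) → HasCount P m → HasCount (c ◂ P) m
  count-◂ {P} c (l , unique , member , len) =
    map (c ∷_) l , Unique.map⁺ ∷-injectiveʳ unique , (λ v → mk⇔ (split v) (join v)) ,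
    trans (length-map (c ∷_) l) len
    where
    split : ∀ v → v ∈ map (c ∷_) l → (c ◂ P) v
    split v v∈ with ∈-map⁻ (c ∷_) v∈
    ... | w , w∈l , refl = w , refl , to (member w) w∈l
    join : ∀ v → (c ◂ P) v → v ∈ map (c ∷_) l
    join .(c ∷ w) (w , refl , Pw) = ∈-map⁺ (c ∷_) (from (member w) Pw)

  ◂-disjoint : {P Q : List A → Set} {c d : A} → ¬ c ≡ d → ∀ v → (c ◂ P) v → ¬ (d ◂ Q) v
  ◂-disjoint c≢d v (_ , refl , _) (_ , c∷w≡d∷w′ , _) = c≢d (∷-injectiveˡ c∷w≡d∷w′)

0≢1 : ¬ 0 ≡ 1
0≢1 ()

count-by-first-letter : {R P Q : List ℕ → Set} {m n : ℕ} →
  (∀ v → R v ⇔ ((0 ◂ P) v ⊎ (1 ◂ Q) v)) → HasCount P m → HasCount Q n → HasCount R (m + n)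
count-by-first-letter split countP countQ =
  count-via split (count-⊎ (◂-disjoint 0≢1) (count-◂ 0 countP) (count-◂ 1 countQ))

Binary : ℕ → List ℕ → Set
Binary n w = length w ≡ n × All (_≤ 1) w

BinaryAsc : ℕ → ℕ → ℕ → List ℕ → Set
BinaryAsc n b k w = Binary n w × ascFrom b w ≡ k

binary-zero : ∀ w → Binary 0 w ⇔ w ≡ []
binary-zero []      = mk⇔ (λ _ → refl) (λ _ → refl , [])
binary-zero (_ ∷ _) = mk⇔ (λ { (() , _) }) (λ ())

binary-suc : ∀ n v → Binary (suc n) v ⇔ ((0 ◂ Binary n) v ⊎ (1 ◂ Binary n) v)
binary-suc n v = mk⇔ split join
  where
  split : ∀ {v} → Binary (suc n) v → (0 ◂ Binary n) v ⊎ (1 ◂ Binary n) v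
  split {_ ∷ w} (len , z≤n ∷ bits)     = inj₁ (w , refl , suc-injective len , bits)
  split {_ ∷ w} (len , s≤s z≤n ∷ bits) = inj₂ (w , refl , suc-injective len , bits)
  join : ∀ {v} → (0 ◂ Binary n) v ⊎ (1 ◂ Binary n) v → Binary (suc n) v
  join (inj₁ (_ , refl , len , bits)) = cong suc len , z≤n ∷ bits
  join (inj₂ (_ , refl , len , bits)) = cong suc len , s≤s z≤n ∷ bits

ascents-empty : ∀ b w → BinaryAsc 0 b 0 w ⇔ w ≡ []
ascents-empty b w = mk⇔ (λ (bin , _) → to (binary-zero w) bin) (λ { refl → (refl , []) , refl })

no-ascents-empty : ∀ b k w → ¬ BinaryAsc 0 b (suc k) w
no-ascents-empty b k []      (_ , ())
no-ascents-empty b k (_ ∷ _) ((() , _) , _)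

-- After a letter 1 no first letter creates an ascent.
ascents-after-1 : ∀ n k v →
  BinaryAsc (suc n) 1 k v ⇔ ((0 ◂ BinaryAsc n 0 k) v ⊎ (1 ◂ BinaryAsc n 1 k) v)
ascents-after-1 n k v = mk⇔ split join
  where
  split : BinaryAsc (suc n) 1 k v → (0 ◂ BinaryAsc n 0 k) v ⊎ (1 ◂ BinaryAsc n 1 k) v
  split (bin , ascents) with to (binary-suc n v) bin
  ... | inj₁ (w , refl , bin′) = inj₁ (w , refl , bin′ , ascents)
  ... | inj₂ (w , refl , bin′) = inj₂ (w , refl , bin′ , ascents)
  join : (0 ◂ BinaryAsc n 0 k) v ⊎ (1 ◂ BinaryAsc n 1 k) v → BinaryAsc (suc n) 1 k v
  join (inj₁ (w , refl , bin′ , ascents)) = from (binary-suc n v) (inj₁ (w , refl , bin′)) , ascents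
  join (inj₂ (w , refl , bin′ , ascents)) = from (binary-suc n v) (inj₂ (w , refl , bin′)) , ascents

-- After a letter 0 a first letter 1 is an ascent, so with no ascents it must be 0.
ascents-after-0-zero : ∀ n v → BinaryAsc (suc n) 0 0 v ⇔ (0 ◂ BinaryAsc n 0 0) v
ascents-after-0-zero n v = mk⇔ split join
  where
  split : BinaryAsc (suc n) 0 0 v → (0 ◂ BinaryAsc n 0 0) v
  split (bin , ascents) with to (binary-suc n v) bin
  ... | inj₁ (w , refl , bin′) = w , refl , bin′ , ascents
  split (bin , ()) | inj₂ (w , refl , bin′)
  join : (0 ◂ BinaryAsc n 0 0) v → BinaryAsc (suc n) 0 0 v
  join (w , refl , bin′ , ascents) = from (binary-suc n v) (inj₁ (w , refl , bin′)) , ascents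

-- After a letter 0 a first letter 1 is an ascent, the remaining ones follow it.
ascents-after-0-suc : ∀ n k v →
  BinaryAsc (suc n) 0 (suc k) v ⇔ ((0 ◂ BinaryAsc n 0 (suc k)) v ⊎ (1 ◂ BinaryAsc n 1 k) v)
ascents-after-0-suc n k v = mk⇔ split join
  where
  split : BinaryAsc (suc n) 0 (suc k) v → (0 ◂ BinaryAsc n 0 (suc k)) v ⊎ (1 ◂ BinaryAsc n 1 k) v
  split (bin , ascents) with to (binary-suc n v) bin
  ... | inj₁ (w , refl , bin′) = inj₁ (w , refl , bin′ , ascents)
  ... | inj₂ (w , refl , bin′) = inj₂ (w , refl , bin′ , suc-injective ascents)
  join : (0 ◂ BinaryAsc n 0 (suc k)) v ⊎ (1 ◂ BinaryAsc n 1 k) v → BinaryAsc (suc n) 0 (suc k) v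
  join (inj₁ (w , refl , bin′ , ascents)) = from (binary-suc n v) (inj₁ (w , refl , bin′)) , ascents
  join (inj₂ (w , refl , bin′ , ascents)) = from (binary-suc n v) (inj₂ (w , refl , bin′)) , cong suc ascents

count-binary : ∀ n → HasCount (Binary n) (2 ^ n)
count-binary zero    = count-via binary-zero (count-single [])
count-binary (suc n) =
  subst (HasCount (Binary (suc n))) (cong (2 ^ n +_) (sym (+-identityʳ (2 ^ n))))
    (count-by-first-letter (binary-suc n) (count-binary n) (count-binary n))

1C[2+j]≡0 : ∀ j → 1 C (2 + j) ≡ 0
1C[2+j]≡0 j = k>n⇒nCk≡0 {1} {2 + j} (s≤s (s≤s z≤n))

pascal-even : ∀ m k → m C (2 * suc k) + m C suc (2 * k) ≡ suc m C (2 * suc k)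
pascal-even m k = begin
  m C (2 * suc k) + m C suc (2 * k)   ≡⟨ +-comm (m C (2 * suc k)) _ ⟩
  m C suc (2 * k) + m C (2 * suc k)   ≡⟨ cong (λ j → m C suc (2 * k) + m C j) (*-suc 2 k) ⟩
  m C suc (2 * k) + m C (2 + 2 * k)   ≡⟨ nCk+nC[k+1]≡[n+1]C[k+1] m (suc (2 * k)) ⟩
  suc m C (2 + 2 * k)                 ≡⟨ cong (suc m C_) (sym (*-suc 2 k)) ⟩
  suc m C (2 * suc k)                 ∎
  where open ≡-Reasoning

count-ascents : ∀ n k →
  HasCount (BinaryAsc n 0 k) (suc n C (2 * k)) × HasCount (BinaryAsc n 1 k) (suc n C suc (2 * k))
count-ascents zero zero =
  count-via (ascents-empty 0) (count-single []) , count-via (ascents-empty 1) (count-single [])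
count-ascents zero (suc k) =
  subst (HasCount _) (sym (trans (cong (1 C_) (*-suc 2 k)) (1C[2+j]≡0 (2 * k))))
    (count-none (no-ascents-empty 0 k)) ,
  subst (HasCount _) (sym (trans (cong (λ j → 1 C suc j) (*-suc 2 k)) (1C[2+j]≡0 (suc (2 * k)))))
    (count-none (no-ascents-empty 1 k))
count-ascents (suc n) k = after-0 k , after-1
  where
  after-0 : ∀ k → HasCount (BinaryAsc (suc n) 0 k) (suc (suc n) C (2 * k))
  after-0 zero    = count-via (ascents-after-0-zero n) (count-◂ 0 (proj₁ (count-ascents n zero)))
  after-0 (suc k) = subst (HasCount _) (pascal-even (suc n) k)
    (count-by-first-letter (ascents-after-0-suc n k)
      (proj₁ (count-ascents n (suc k))) (proj₂ (count-ascents n k)))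
  after-1 : HasCount (BinaryAsc (suc n) 1 k) (suc (suc n) C suc (2 * k))
  after-1 = subst (HasCount _) (nCk+nC[k+1]≡[n+1]C[k+1] (suc n) (2 * k))
    (count-by-first-letter (ascents-after-1 n k)
      (proj₁ (count-ascents n k)) (proj₂ (count-ascents n k)))

ascFrom-zeros : ∀ ys → All (_≡ 0) ys → ascFrom 0 ys ≡ 0
ascFrom-zeros []        []             = refl
ascFrom-zeros (.0 ∷ ys) (refl ∷ zeros) = ascFrom-zeros ys zeros

asc-zeros : ∀ ys → All (_≡ 0) ys → asc ys ≡ 0
asc-zeros []        []             = refl
asc-zeros (.0 ∷ ys) (refl ∷ zeros) = ascFrom-zeros ys zeros

All-take : {P : ℕ → Set} (x : List ℕ) (m : ℕ) →
           (∀ (j : Fin (length x)) → toℕ j < m → P (lookup x j)) → All P (take m x)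
All-take x       zero    _      = []
All-take []      (suc m) _      = []
All-take (y ∷ x) (suc m) before = before fzero (s≤s z≤n) ∷ All-take x m (λ j j<m → before (fsuc j) (s≤s j<m))

All-lookup : {P : ℕ → Set} (x : List ℕ) → (∀ i → P (lookup x i)) → All P x
All-lookup {P} x entry = All.tabulate (λ x∈ → subst P (sym (lookup-index x∈)) (entry (index x∈)))

≤1-≢1⇒≡0 : ∀ {c} → c ≤ 1 → ¬ c ≡ 1 → c ≡ 0
≤1-≢1⇒≡0 z≤n       _   = refl
≤1-≢1⇒≡0 (s≤s z≤n) c≢1 = ⊥-elim (c≢1 refl)

≤1-after-1 : ∀ {w} (i j : Fin (length (0 ∷ w))) → Avoids012 (0 ∷ w) →
             j <ᶠ i → lookup (0 ∷ w) j ≡ 1 → lookup (0 ∷ w) i ≤ 1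
≤1-after-1 i fzero     avoids j<i ()
≤1-after-1 {w} i (fsuc j) avoids j<i xj≡1 with lookup (0 ∷ w) i ≤? 1
... | yes xi≤1 = xi≤1
... | no  xi≰1 = ⊥-elim
  (avoids (fzero , fsuc j , i , s≤s z≤n , j<i , subst (0 <_) (sym xj≡1) (s≤s z≤n) ,
           subst (_< lookup (0 ∷ w) i) (sym xj≡1) (≰⇒> xi≰1)))

entries≤1 : ∀ {w} → IsAscentSeq (0 ∷ w) → Avoids012 (0 ∷ w) → ∀ i → lookup (0 ∷ w) i ≤ 1
entries≤1 {w} (_ , bounded) avoids =
  WellFounded.All.wfRec <-wellFounded 0ℓ (λ i → lookup x i ≤ 1) step
  where
  x = 0 ∷ w
  step : ∀ i → (∀ {j} → j <ᶠ i → lookup x j ≤ 1) → lookup x i ≤ 1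
  step fzero    _       = z≤n
  step (fsuc i) earlier with any? (λ j → (toℕ j <? toℕ (fsuc i)) ×-dec (lookup x j ≟ 1))
  ... | yes (j , j<i , xj≡1) = ≤1-after-1 (fsuc i) j avoids j<i xj≡1
  ... | no  no-earlier-1     =
    subst (λ a → lookup x (fsuc i) ≤ a + 1) (asc-zeros (take (toℕ (fsuc i)) x) prefix-zeros)
      (bounded (fsuc i) (s≤s z≤n))
    where
    prefix-zeros : All (_≡ 0) (take (toℕ (fsuc i)) x)
    prefix-zeros = All-take x (toℕ (fsuc i))
      (λ j j<i → ≤1-≢1⇒≡0 (earlier j<i) (λ xj≡1 → no-earlier-1 (j , j<i , xj≡1)))

binary⇒av012 : ∀ m w → Binary m w → Av012 (suc m) (0 ∷ w)
binary⇒av012 m w (len , bits) = cong suc len , (first , bounded) , avoids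
  where
  entry≤1 : ∀ i → lookup (0 ∷ w) i ≤ 1
  entry≤1 i = All.lookup (z≤n ∷ bits) (∈-lookup i)
  first : ∀ i → toℕ i ≡ 0 → lookup (0 ∷ w) i ≡ 0
  first fzero    _ = refl
  first (fsuc i) ()
  bounded : ∀ i → 1 ≤ toℕ i → lookup (0 ∷ w) i ≤ asc (take (toℕ i) (0 ∷ w)) + 1
  bounded i _ = ≤-trans (entry≤1 i) (m≤n+m 1 _)
  no-two : ∀ {a} → ¬ 2 + a ≤ 1
  no-two (s≤s ())
  avoids : Avoids012 (0 ∷ w)
  avoids (_ , _ , k , _ , _ , xi<xj , xj<xk) = no-two (≤-trans (≤-trans (s≤s xi<xj) xj<xk) (entry≤1 k))

av012⇔binary : ∀ m x → Av012 (suc m) x ⇔ (0 ◂ Binary m) x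
av012⇔binary m x = mk⇔ split (λ { (w , refl , bin) → binary⇒av012 m w bin })
  where
  split : ∀ {x} → Av012 (suc m) x → (0 ◂ Binary m) x
  split {y ∷ w} (len , ascent@(first , _) , avoids) with first fzero refl
  ... | refl = w , refl , suc-injective len , All.tail (All-lookup (0 ∷ w) (entries≤1 ascent avoids))

av012-asc⇔binary : ∀ m k x → (Av012 (suc m) x × asc x ≡ k) ⇔ (0 ◂ BinaryAsc m 0 k) x
av012-asc⇔binary m k x = mk⇔ split join
  where
  split : Av012 (suc m) x × asc x ≡ k → (0 ◂ BinaryAsc m 0 k) x
  split (av , ascents) with to (av012⇔binary m x) av
  ... | w , refl , bin = w , refl , bin , ascents
  join : (0 ◂ BinaryAsc m 0 k) x → Av012 (suc m) x × asc x ≡ k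
  join (w , refl , bin , ascents) = from (av012⇔binary m x) (w , refl , bin) , ascents

theorem2p2 : ∀ (n : ℕ) → 1 ≤ n →
    HasCount (Av012 n) (2 ^ (n ∸ 1)) ×
    (∀ (k : ℕ) → HasCount (λ x → Av012 n x × asc x ≡ k) (n C (2 * k)))
theorem2p2 (suc m) _ =
  count-via (av012⇔binary m) (count-◂ 0 (count-binary m)) ,
  λ k → count-via (av012-asc⇔binary m k) (count-◂ 0 (proj₁ (count-ascents m k)))
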